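{- Let $K_1$ and $K_2$ be two bipartite graphs with ranked edges on the same vertex set $A\cup P$ that coincide except for the edges incident to the applicant $a$. In both graphs $a$ has exactly two neighbours and $p$ is a rank one $f$-post (with respect to $a$) in the preference list of $a$; in $K_1$ the other neighbour of $a$ is $p_1$ with rank $i$, and in $K_2$ the other neighbour is $p_2$ with rank $j$, where $p_1\neq p_2$. Let $K_3=K_1\cup K_2$ (so $a$ has $p$ with rank $1$, $p_1$ with rank $i$ and $p_2$ with rank $j$). Then $a$ is matched to $p$ in every rank-maximal matching of $K_1$ and in every rank-maximal matching of $K_2$ if and only if $a$ is matched to $p$ in every rank-maximal matching of $K_3$.
   Context: Edges $(a,p)$ carry positive integer ranks (smaller = more preferred by $a$). A matching is a set of edges no two sharing an endpoint. The signature of a matching in a graph with largest rank $r$ is $(x_1,\dots,x_r)$ with $x_i$ the number of applicants matched by rank $i$ edges; a matching is rank-maximal if its signature is lexicographically largest. For a bipartite graph $K$ with maximum matching $M$, a vertex is even (resp. odd) if reachable from an $M$-unmatched vertex by an $M$-alternating path of even (resp. odd) length, and unreachable otherwise; the sets $O(K),U(K)$ of odd and unreachable vertices do not depend on $M$. A post is an $f$-post with respect to $a$ if it lies in $O(L)\cup U(L)$, where $L$ is the subgraph of rank one edges with the vertex $a$ deleted. -}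

module Defs where

open import Data.Nat using (ℕ; zero; suc; _≤_; _<_; _⊔_; _≡ᵇ_)
open import Data.Fin using (Fin; _≟_)
open import Data.Bool using (Bool; true; false; if_then_else_; not; T)
open import Data.Maybe using (Maybe; just; nothing; fromMaybe; _>>=_)
open import Data.Nat.ListAction using (sum)
open import Data.List using (List; []; _∷_; map; foldr; allFin; upTo; length; concatMap; last)
open import Data.List.Relation.Unary.Unique.Propositional using (Unique)
open import Data.Sum using (_⊎_; inj₁; inj₂)
open import Data.Product using (_×_; Σ; ∃)
open import Data.Unit using (⊤)
open import Data.Empty using (⊥)
open import Relation.Nullary using (¬_; does)
open import Relation.Binary.PropositionalEquality using (_≡_; _≢_)

-- Ranked bipartite graphs on applicants A = Fin m and posts P = Fin n.
-- G a q = just r : there is an edge (a,q) of rank r;  nothing : no edge.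

Graph : ℕ → ℕ → Set
Graph m n = Fin m → Fin n → Maybe ℕ

PositiveRanks : ∀ {m n} → Graph m n → Set
PositiveRanks G = ∀ a q r → G a q ≡ just r → 1 ≤ r

-- a set of edges in which every applicant has at most one edge,
-- represented by the partner of each applicant
Assignment : ℕ → ℕ → Set
Assignment m n = Fin m → Maybe (Fin n)

IsMatching : ∀ {m n} → Graph m n → Assignment m n → Set
IsMatching G M =
  (∀ a q → M a ≡ just q → G a q ≢ nothing) ×
  (∀ a a' q → M a ≡ just q → M a' ≡ just q → a ≡ a')

countA : ∀ {m} → (Fin m → Bool) → ℕ
countA {m} f = sum (map (λ a → if f a then 1 else 0) (allFin m))

size : ∀ {m n} → Assignment m n → ℕ
size M = countA (λ a → isJust' (M a))
  where
  isJust' : ∀ {A : Set} → Maybe A → Bool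
  isJust' (just _) = true
  isJust' nothing  = false

-- largest rank occurring in G (0 if G has no edges)
maxRank : ∀ {m n} → Graph m n → ℕ
maxRank {m} {n} G =
  foldr _⊔_ 0 (concatMap (λ a → map (λ q → fromMaybe 0 (G a q)) (allFin n)) (allFin m))

matchedRank : ∀ {m n} → Graph m n → Assignment m n → Fin m → Maybe ℕ
matchedRank G M a = M a >>= G a

isRank : Maybe ℕ → ℕ → Bool
isRank (just r) k = r ≡ᵇ k
isRank nothing  k = false

signature : ∀ {m n} → Graph m n → Assignment m n → List ℕ
signature G M =
  map (λ k → countA (λ a → isRank (matchedRank G M a) k)) (map suc (upTo (maxRank G)))

data LexLT : List ℕ → List ℕ → Set where
  here  : ∀ {x y xs ys} → x < y → LexLT (x ∷ xs) (y ∷ ys)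
  there : ∀ {x xs ys} → LexLT xs ys → LexLT (x ∷ xs) (x ∷ ys)

RankMaximal : ∀ {m n} → Graph m n → Assignment m n → Set
RankMaximal G M =
  IsMatching G M × (∀ M' → IsMatching G M' → ¬ LexLT (signature G M) (signature G M'))

MaximumMatching : ∀ {m n} → Graph m n → Assignment m n → Set
MaximumMatching G M = IsMatching G M × (∀ M' → IsMatching G M' → size M' ≤ size M)

Vertex : ℕ → ℕ → Set
Vertex m n = Fin m ⊎ Fin n

Adj : ∀ {m n} → Graph m n → Vertex m n → Vertex m n → Set
Adj G (inj₁ a) (inj₂ q) = G a q ≢ nothing
Adj G (inj₂ q) (inj₁ a) = G a q ≢ nothing
Adj G _ _ = ⊥

InM : ∀ {m n} → Assignment m n → Vertex m n → Vertex m n → Set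
InM M (inj₁ a) (inj₂ q) = M a ≡ just q
InM M (inj₂ q) (inj₁ a) = M a ≡ just q
InM M _ _ = ⊥

Unmatched : ∀ {m n} → Assignment m n → Vertex m n → Set
Unmatched M (inj₁ a) = M a ≡ nothing
Unmatched M (inj₂ q) = ∀ a → M a ≢ just q

-- consecutive vertices are adjacent in G and the edges alternate:
-- the edge is in M iff the flag b is true; the flag flips at each step
AltFrom : ∀ {m n} → Graph m n → Assignment m n → Bool → List (Vertex m n) → Set
AltFrom G M b []           = ⊤
AltFrom G M b (v ∷ [])     = ⊤
AltFrom G M b (u ∷ v ∷ vs) =
  Adj G u v × (if b then InM M u v else ¬ InM M u v) × AltFrom G M (not b) (v ∷ vs)

record AltPathTo {m n} (G : Graph m n) (M : Assignment m n) (w : Vertex m n) : Set where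
  field
    start    : Vertex m n
    rest     : List (Vertex m n)
    unmatchd : Unmatched M start
    distinct : Unique (start ∷ rest)
    alt      : AltFrom G M false (start ∷ rest)
    ends     : last (start ∷ rest) ≡ just w

pathLength : ∀ {m n} {G : Graph m n} {M : Assignment m n} {w} → AltPathTo G M w → ℕ
pathLength p = length (AltPathTo.rest p)

evenᵇ : ℕ → Bool
evenᵇ zero    = true
evenᵇ (suc k) = not (evenᵇ k)

IsEven : ∀ {m n} → Graph m n → Assignment m n → Vertex m n → Set
IsEven G M w = Σ (AltPathTo G M w) (λ p → T (evenᵇ (pathLength p)))

IsOdd : ∀ {m n} → Graph m n → Assignment m n → Vertex m n → Set
IsOdd G M w = Σ (AltPathTo G M w) (λ p → T (not (evenᵇ (pathLength p))))

IsUnreachable : ∀ {m n} → Graph m n → Assignment m n → Vertex m n → Set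
IsUnreachable G M w = ¬ IsEven G M w × ¬ IsOdd G M w

-- L : subgraph of rank one edges of G with applicant a deleted
-- (a is kept as an isolated vertex)

rankOneMinus : ∀ {m n} → Graph m n → Fin m → Graph m n
rankOneMinus G a a' q with does (a' ≟ a) | G a' q
... | true  | _      = nothing
... | false | just r = if r ≡ᵇ 1 then just 1 else nothing
... | false | nothing = nothing

-- q is an f-post with respect to a: q ∈ O(L) ∪ U(L), computed w.r.t.
-- (any, equivalently every) maximum matching of L
IsFPost : ∀ {m n} → Graph m n → Fin m → Fin n → Set
IsFPost G a q =
  ∀ M → MaximumMatching (rankOneMinus G a) M →
    IsOdd (rankOneMinus G a) M (inj₂ q) ⊎ IsUnreachable (rankOneMinus G a) M (inj₂ q)

AlwaysMatchedTo : ∀ {m n} → Graph m n → Fin m → Fin n → Set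
AlwaysMatchedTo G a p = ∀ M → RankMaximal G M → M a ≡ just p

row2 : ∀ {n} → Fin n → ℕ → Fin n → ℕ → Fin n → Maybe ℕ
row2 p r p' r' q =
  if does (q ≟ p) then just r else if does (q ≟ p') then just r' else nothing

row3 : ∀ {n} → Fin n → ℕ → Fin n → ℕ → Fin n → ℕ → Fin n → Maybe ℕ
row3 p r p' r' p'' r'' q =
  if does (q ≟ p) then just r else
  if does (q ≟ p') then just r' else
  if does (q ≟ p'') then just r'' else nothing

module Submission where

-- Let H be obtained from a ranked graph G by adding one edge (a , p') (and
-- nothing else).  Then G ⊑ H, and a matching of G has, in H, its G-signature
-- followed by zeros; hence lexicographic comparisons between G-matchings are
-- the same in G and in H (signature-⊑, lex-⊑, lex-⊑⁻).  Two consequences: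
--   * a rank-maximal matching of H that avoids (a , p') is rank-maximal in G;
--   * if a is matched to p ≠ p' in every rank-maximal matching of H, then also
--     in every rank-maximal matching M of G: some rank-maximal N of H is at
--     least as good as M, N uses (a , p) and so lives in G, which forces M and
--     N to have equal H-signatures, i.e. M is rank-maximal in H.
-- The second point needs the existence of rank-maximal matchings, proved by
-- well-founded induction on the signature read as a number in base m + 1.
-- K₃ extends K₁ by (a , p₂) and K₂ by (a , p₁); the theorem follows from these
-- two facts by splitting on whether a rank-maximal matching of K₃ uses
-- (a , p₂).

open import Defs
open import Data.Nat using (ℕ; zero; suc; _≤_; _<_; _⊔_; _≡ᵇ_; _+_; _*_; _^_; _∸_; z≤n; s≤s)
open import Data.Nat.Properties hiding (_≟_)
open import Data.Nat.Induction using (<-rec)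
open import Data.Nat.ListAction using (sum)
open import Data.Fin using (Fin; _≟_)
open import Data.Bool using (Bool; true; false; if_then_else_; T)
open import Data.Maybe using (just; nothing; fromMaybe)
open import Data.Maybe.Properties using (just-injective) renaming (≡-dec to maybe-≡-dec)
open import Data.List using (List; []; _∷_; map; foldr; allFin; length; _++_; applyUpTo)
open import Data.List.Properties using (map-cong; map-upTo; map-applyUpTo; length-applyUpTo; length-tabulate)
open import Data.List.Membership.Propositional using (_∈_)
open import Data.List.Membership.Propositional.Properties using (∈-map⁺; ∈-concatMap⁺; ∈-allFin)
open import Data.List.Relation.Unary.All using (All; []; _∷_)
import Data.List.Relation.Unary.All.Properties as All
import Data.List.Relation.Unary.Any.Properties as Any
open import Data.List.Relation.Unary.Any using (here; there)
open import Data.Product using (_×_; _,_; ∃)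
open import Data.Sum using (_⊎_; inj₁; inj₂)
open import Data.Empty using (⊥; ⊥-elim)
open import Relation.Nullary using (¬_; yes; no)
open import Relation.Binary.Definitions using (tri<; tri≈; tri>)
open import Relation.Binary.PropositionalEquality
open import Function.Bundles using (_⇔_; mk⇔)

lex-irrefl : ∀ {xs} → ¬ LexLT xs xs
lex-irrefl (here x<x) = <-irrefl refl x<x
lex-irrefl (there l)  = lex-irrefl l

lex-trans : ∀ {xs ys zs} → LexLT xs ys → LexLT ys zs → LexLT xs zs
lex-trans (here x<y) (here y<z) = here (<-trans x<y y<z)
lex-trans (here x<y) (there _)  = here x<y
lex-trans (there _)  (here y<z) = here y<z
lex-trans (there l)  (there l') = there (lex-trans l l')

lex-trichotomy : ∀ xs ys → length xs ≡ length ys → LexLT xs ys ⊎ xs ≡ ys ⊎ LexLT ys xs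
lex-trichotomy []       []       _ = inj₂ (inj₁ refl)
lex-trichotomy (x ∷ xs) (y ∷ ys) e with <-cmp x y
... | tri< x<y _ _ = inj₁ (here x<y)
... | tri> _ _ y<x = inj₂ (inj₂ (here y<x))
... | tri≈ _ refl _ with lex-trichotomy xs ys (suc-injective e)
...   | inj₁ l          = inj₁ (there l)
...   | inj₂ (inj₁ refl) = inj₂ (inj₁ refl)
...   | inj₂ (inj₂ l)   = inj₂ (inj₂ (there l))

lex-++ʳ : ∀ {xs ys} zs → LexLT xs ys → LexLT (xs ++ zs) (ys ++ zs)
lex-++ʳ zs (here x<y) = here x<y
lex-++ʳ zs (there l)  = there (lex-++ʳ zs l)

lex-++ʳ⁻ : ∀ xs ys zs → length xs ≡ length ys → LexLT (xs ++ zs) (ys ++ zs) → LexLT xs ys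
lex-++ʳ⁻ []       []        zs _ l          = ⊥-elim (lex-irrefl l)
lex-++ʳ⁻ (x ∷ xs) (y ∷ ys)  zs _ (here x<y) = here x<y
lex-++ʳ⁻ (x ∷ xs) (.x ∷ ys) zs e (there l)  = there (lex-++ʳ⁻ xs ys zs (suc-injective e) l)

-- Reading a list as the digits of a number in base b turns the
-- lexicographic order on bounded lists of equal length into < on ℕ

value : ℕ → List ℕ → ℕ
value b []       = 0
value b (x ∷ xs) = x * b ^ length xs + value b xs

leading-digit : ∀ {x y} B {v} → x < y → v < B → x * B + v < y * B
leading-digit {x} {y} B {v} x<y v<B = begin-strict
  x * B + v  <⟨ +-monoʳ-< (x * B) v<B ⟩
  x * B + B  ≡⟨ +-comm (x * B) B ⟩
  suc x * B  ≤⟨ *-monoˡ-≤ B x<y ⟩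
  y * B      ∎
  where open ≤-Reasoning

value-bound : ∀ b xs → All (_< b) xs → value b xs < b ^ length xs
value-bound b []       []          = s≤s z≤n
value-bound b (x ∷ xs) (x<b ∷ xs<b) = leading-digit (b ^ length xs) x<b (value-bound b xs xs<b)

lex⇒value< : ∀ b xs ys → length xs ≡ length ys → All (_< b) xs →
             LexLT xs ys → value b xs < value b ys
lex⇒value< b (x ∷ xs) (y ∷ ys) e (_ ∷ xs<b) (here x<y) rewrite suc-injective e =
  ≤-trans (leading-digit (b ^ length ys) x<y xs-small) (m≤m+n (y * b ^ length ys) (value b ys))
  where
  xs-small : value b xs < b ^ length ys
  xs-small = subst (λ k → value b xs < b ^ k) (suc-injective e) (value-bound b xs xs<b)
lex⇒value< b (x ∷ xs) (.x ∷ ys) e (_ ∷ xs<b) (there l) rewrite suc-injective e =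
  +-monoʳ-< (x * b ^ length ys) (lex⇒value< b xs ys (suc-injective e) xs<b l)

applyUpTo-cong : ∀ {f g : ℕ → ℕ} k → (∀ i → f i ≡ g i) → applyUpTo f k ≡ applyUpTo g k
applyUpTo-cong zero    f≗g = refl
applyUpTo-cong (suc k) f≗g = cong₂ _∷_ (f≗g 0) (applyUpTo-cong k (λ i → f≗g (suc i)))

applyUpTo-+ : ∀ (f : ℕ → ℕ) k l → applyUpTo f (k + l) ≡ applyUpTo f k ++ applyUpTo (λ i → f (k + i)) l
applyUpTo-+ f zero    l = refl
applyUpTo-+ f (suc k) l = cong (f 0 ∷_) (applyUpTo-+ (λ i → f (suc i)) k l)

foldr-⊔-upper : ∀ {x xs} → x ∈ xs → x ≤ foldr _⊔_ 0 xs
foldr-⊔-upper {xs = y ∷ ys} (here refl) = m≤m⊔n y (foldr _⊔_ 0 ys)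
foldr-⊔-upper {xs = y ∷ ys} (there x∈)  = ≤-trans (foldr-⊔-upper x∈) (m≤n⊔m y (foldr _⊔_ 0 ys))

foldr-⊔-least : ∀ {b xs} → All (_≤ b) xs → foldr _⊔_ 0 xs ≤ b
foldr-⊔-least []           = z≤n
foldr-⊔-least (x≤b ∷ xs≤b) = ⊔-lub x≤b (foldr-⊔-least xs≤b)

countA-bound : ∀ {m} (f : Fin m → Bool) → countA f ≤ m
countA-bound {m} f = subst (countA f ≤_) (length-tabulate {n = m} (λ a → a)) (go (allFin m))
  where
  go : (as : List (Fin m)) → sum (map (λ a → if f a then 1 else 0) as) ≤ length as
  go []       = z≤n
  go (a ∷ as) with f a
  ... | true  = s≤s (go as)
  ... | false = m≤n⇒m≤1+n (go as)

countA-cong : ∀ {m} (f g : Fin m → Bool) → (∀ a → f a ≡ g a) → countA f ≡ countA g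
countA-cong {m} f g f≗g = cong sum (map-cong (λ a → cong (λ b → if b then 1 else 0) (f≗g a)) (allFin m))

countA-none : ∀ {m} (f : Fin m → Bool) → (∀ a → f a ≡ false) → countA f ≡ 0
countA-none {m} f none = go (allFin m)
  where
  go : (as : List (Fin m)) → sum (map (λ a → if f a then 1 else 0) as) ≡ 0
  go []       = refl
  go (a ∷ as) rewrite none a = go as

just≢nothing : ∀ {A : Set} {x : A} → just x ≢ nothing
just≢nothing ()

module _ {m n : ℕ} where

  rank≤maxRank : (G : Graph m n) → ∀ a q r → G a q ≡ just r → r ≤ maxRank G
  rank≤maxRank G a q r e = foldr-⊔-upper (∈-concatMap⁺ row (Any.tabulate⁺ a r∈row))
    where
    row : Fin m → List ℕ
    row a = map (λ q → fromMaybe 0 (G a q)) (allFin n)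
    r∈row : r ∈ row a
    r∈row = subst (_∈ row a) (cong (fromMaybe 0) e) (∈-map⁺ (λ q → fromMaybe 0 (G a q)) (∈-allFin q))

  maxRank-least : (G : Graph m n) → ∀ b → (∀ a q → fromMaybe 0 (G a q) ≤ b) → maxRank G ≤ b
  maxRank-least G b bound =
    foldr-⊔-least (All.concat⁺ (All.map⁺ (All.tabulate⁺ (λ a → All.map⁺ (All.tabulate⁺ (bound a))))))

  rankCount : Graph m n → Assignment m n → ℕ → ℕ
  rankCount G M k = countA (λ a → isRank (matchedRank G M a) k)

  signature-applyUpTo : (G : Graph m n) (M : Assignment m n) →
    signature G M ≡ applyUpTo (λ k → rankCount G M (suc k)) (maxRank G)
  signature-applyUpTo G M =
    trans (cong (map (rankCount G M)) (map-upTo suc (maxRank G))) (map-applyUpTo suc (rankCount G M) (maxRank G))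

  signature-length : (G : Graph m n) (M : Assignment m n) → length (signature G M) ≡ maxRank G
  signature-length G M = trans (cong length (signature-applyUpTo G M)) (length-applyUpTo _ (maxRank G))

  signature-bounded : (G : Graph m n) (M : Assignment m n) → All (_< suc m) (signature G M)
  signature-bounded G M = subst (All (_< suc m)) (sym (signature-applyUpTo G M))
    (All.applyUpTo⁺₂ _ (maxRank G) (λ k → s≤s (countA-bound _)))

  rankCount-beyond : (G : Graph m n) (M : Assignment m n) → ∀ k → maxRank G < k → rankCount G M k ≡ 0
  rankCount-beyond G M k max<k = countA-none _ noneOfRank
    where
    noneOfRank : ∀ a → isRank (matchedRank G M a) k ≡ false
    noneOfRank a with M a
    ... | nothing = refl
    ... | just q with G a q in e
    ...   | nothing = refl
    ...   | just r with r ≡ᵇ k in r≡ᵇk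
    ...     | false = refl
    ...     | true  = ⊥-elim (<-irrefl (≡ᵇ⇒≡ r k (subst T (sym r≡ᵇk) _)) (≤-<-trans (rank≤maxRank G a q r e) max<k))

  _⊑_ : Graph m n → Graph m n → Set
  G ⊑ H = ∀ a q r → G a q ≡ just r → H a q ≡ just r

  maxRank-mono : (G H : Graph m n) → G ⊑ H → maxRank G ≤ maxRank H
  maxRank-mono G H G⊑H = maxRank-least G (maxRank H) bound
    where
    bound : ∀ a q → fromMaybe 0 (G a q) ≤ maxRank H
    bound a q with G a q in e
    ... | nothing = z≤n
    ... | just r  = rank≤maxRank H a q r (G⊑H a q r e)

  matching-mono : (G H : Graph m n) → G ⊑ H → ∀ M → IsMatching G M → IsMatching H M
  matching-mono G H G⊑H M (inG , injective) = inH , injective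
    where
    inH : ∀ a q → M a ≡ just q → H a q ≢ nothing
    inH a q Ma with G a q in e
    ... | nothing = ⊥-elim (inG a q Ma e)
    ... | just r  = λ Hnothing → just≢nothing (trans (sym (G⊑H a q r e)) Hnothing)

  matching-restrict : (G H : Graph m n) (M : Assignment m n) → IsMatching H M →
    (∀ a q s → M a ≡ just q → H a q ≡ just s → G a q ≡ just s) → IsMatching G M
  matching-restrict G H M (inH , injective) agree = inG , injective
    where
    inG : ∀ a q → M a ≡ just q → G a q ≢ nothing
    inG a q Ma with H a q in e
    ... | nothing = ⊥-elim (inH a q Ma e)
    ... | just s  = λ Gnothing → just≢nothing (trans (sym (agree a q s Ma e)) Gnothing)

  matchedRank-⊑ : (G H : Graph m n) → G ⊑ H → ∀ M → IsMatching G M →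
    ∀ a → matchedRank H M a ≡ matchedRank G M a
  matchedRank-⊑ G H G⊑H M (inG , _) a with M a in Ma
  ... | nothing = refl
  ... | just q with G a q in e
  ...   | nothing = ⊥-elim (inG a q Ma e)
  ...   | just r  = G⊑H a q r e

  zeros : ℕ → List ℕ
  zeros k = applyUpTo (λ _ → 0) k

  signature-⊑ : (G H : Graph m n) → G ⊑ H → ∀ M → IsMatching G M →
    signature H M ≡ signature G M ++ zeros (maxRank H ∸ maxRank G)
  signature-⊑ G H G⊑H M mM = begin
      signature H M
    ≡⟨ signature-applyUpTo H M ⟩
      applyUpTo (λ k → rankCount H M (suc k)) (maxRank H)
    ≡⟨ applyUpTo-cong (maxRank H) (λ k → countA-cong _ _ (λ a → cong (λ r → isRank r (suc k)) (matchedRank-⊑ G H G⊑H M mM a))) ⟩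
      applyUpTo count (maxRank H)
    ≡⟨ cong (applyUpTo count) (sym (m+[n∸m]≡n (maxRank-mono G H G⊑H))) ⟩
      applyUpTo count (maxRank G + d)
    ≡⟨ applyUpTo-+ count (maxRank G) d ⟩
      applyUpTo count (maxRank G) ++ applyUpTo (λ k → count (maxRank G + k)) d
    ≡⟨ cong₂ _++_ (sym (signature-applyUpTo G M)) (applyUpTo-cong d (λ k → rankCount-beyond G M _ (s≤s (m≤m+n (maxRank G) k)))) ⟩
      signature G M ++ zeros d
    ∎
    where
    open ≡-Reasoning
    count : ℕ → ℕ
    count k = rankCount G M (suc k)
    d : ℕ
    d = maxRank H ∸ maxRank G

  lex-⊑ : (G H : Graph m n) → G ⊑ H → ∀ M N → IsMatching G M → IsMatching G N →
    LexLT (signature G M) (signature G N) → LexLT (signature H M) (signature H N)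
  lex-⊑ G H G⊑H M N mM mN l rewrite signature-⊑ G H G⊑H M mM | signature-⊑ G H G⊑H N mN =
    lex-++ʳ _ l

  lex-⊑⁻ : (G H : Graph m n) → G ⊑ H → ∀ M N → IsMatching G M → IsMatching G N →
    LexLT (signature H M) (signature H N) → LexLT (signature G M) (signature G N)
  lex-⊑⁻ G H G⊑H M N mM mN l rewrite signature-⊑ G H G⊑H M mM | signature-⊑ G H G⊑H N mN =
    lex-++ʳ⁻ _ _ _ (trans (signature-length G M) (sym (signature-length G N))) l

  rankMaximal-⊑ : (G H : Graph m n) → G ⊑ H → ∀ N → RankMaximal H N → IsMatching G N → RankMaximal G N
  rankMaximal-⊑ G H G⊑H N (_ , maximalH) mN =
    mN , λ N' mN' l → maximalH N' (matching-mono G H G⊑H N' mN') (lex-⊑ G H G⊑H N N' mN mN' l)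

  -- Since
  -- matchings are not enumerated, this holds in double-negated form, which
  -- suffices for the decidable conclusions drawn from it.

  rankMaximal-dominates : (H : Graph m n) (M : Assignment m n) → IsMatching H M →
    ¬ ¬ ∃ λ N → RankMaximal H N × ¬ LexLT (signature H N) (signature H M)
  rankMaximal-dominates H M mM noneDominates =
    <-rec Unbeaten step (bound ∸ score M) M mM refl lex-irrefl
    where
    bound : ℕ
    bound = suc m ^ maxRank H
    score : Assignment m n → ℕ
    score N = value (suc m) (signature H N)
    score<bound : ∀ N → score N < bound
    score<bound N = subst (λ k → score N < suc m ^ k) (signature-length H N)
      (value-bound (suc m) _ (signature-bounded H N))
    Unbeaten : ℕ → Set
    Unbeaten k = ∀ N → IsMatching H N → bound ∸ score N ≡ k →
                 ¬ LexLT (signature H N) (signature H M) → ⊥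
    step : ∀ k → (∀ {k'} → k' < k → Unbeaten k') → Unbeaten k
    step k ih N mN refl N≮M = noneDominates (N , (mN , better) , N≮M)
      where
      better : ∀ N' → IsMatching H N' → ¬ LexLT (signature H N) (signature H N')
      better N' mN' N<N' = ih closer N' mN' refl (λ N'<M → N≮M (lex-trans N<N' N'<M))
        where
        closer : bound ∸ score N' < bound ∸ score N
        closer = ∸-monoʳ-< (lex⇒value< (suc m) _ _
                   (trans (signature-length H N) (sym (signature-length H N')))
                   (signature-bounded H N) N<N') (<⇒≤ (score<bound N'))

  alwaysMatched-⊑ : (G H : Graph m n) (a : Fin m) (p : Fin n) → G ⊑ H →
    (∀ N → N a ≡ just p → IsMatching H N → IsMatching G N) →
    AlwaysMatchedTo H a p → AlwaysMatchedTo G a p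
  alwaysMatched-⊑ G H a p G⊑H restrict alwaysH M (mM , maximalG)
    with maybe-≡-dec _≟_ (M a) (just p)
  ... | yes Ma≡p = Ma≡p
  ... | no Ma≢p  = ⊥-elim (rankMaximal-dominates H M mMH contradiction)
    where
    mMH : IsMatching H M
    mMH = matching-mono G H G⊑H M mM
    contradiction : ¬ ∃ λ N → RankMaximal H N × ¬ LexLT (signature H N) (signature H M)
    contradiction (N , (mNH , maximalH) , N≮M)
      with lex-trichotomy (signature H N) (signature H M)
             (trans (signature-length H N) (sym (signature-length H M)))
    ... | inj₁ N<M         = N≮M N<M
    ... | inj₂ (inj₂ M<N)  = maximalG N mNG (lex-⊑⁻ G H G⊑H M N mM mNG M<N)
      where
      mNG : IsMatching G N
      mNG = restrict N (alwaysH N (mNH , maximalH)) mNH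
    ... | inj₂ (inj₁ N≡M) = Ma≢p (alwaysH M (mMH , maximalM))
      where
      maximalM : ∀ M' → IsMatching H M' → ¬ LexLT (signature H M) (signature H M')
      maximalM M' mM' M<M' = maximalH M' mM' (subst (λ s → LexLT s (signature H M')) (sym N≡M) M<M')

  record EdgeExtension (G H : Graph m n) (a : Fin m) (p' : Fin n) : Set where
    field
      others : ∀ a' → a' ≢ a → ∀ q → H a' q ≡ G a' q
      row    : ∀ q → q ≢ p' → H a q ≡ G a q
      absent : G a p' ≡ nothing

  module _ {G H : Graph m n} {a : Fin m} {p' : Fin n} (ext : EdgeExtension G H a p') where
    open EdgeExtension ext

    agreeAway : ∀ a' q → (a' ≡ a → q ≢ p') → H a' q ≡ G a' q
    agreeAway a' q away with a' ≟ a
    ... | yes refl = row q (away refl)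
    ... | no a'≢a  = others a' a'≢a q

    extension-⊑ : G ⊑ H
    extension-⊑ a' q r e = trans (agreeAway a' q away) e
      where
      away : a' ≡ a → q ≢ p'
      away refl refl = just≢nothing (trans (sym e) absent)

    extension-restrict : ∀ N → N a ≢ just p' → IsMatching H N → IsMatching G N
    extension-restrict N Na≢p' mN = matching-restrict G H N mN agree
      where
      agree : ∀ a' q s → N a' ≡ just q → H a' q ≡ just s → G a' q ≡ just s
      agree a' q s Na' e = trans (sym (agreeAway a' q (λ { refl refl → Na≢p' Na' }))) e

    alwaysMatched-remove : ∀ {p} → p ≢ p' → AlwaysMatchedTo H a p → AlwaysMatchedTo G a p
    alwaysMatched-remove p≢p' = alwaysMatched-⊑ G H a _ extension-⊑
      (λ N Na≡p mN → extension-restrict N (λ Na≡p' → p≢p' (just-injective (trans (sym Na≡p) Na≡p'))) mN)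

  alwaysMatched-union : ∀ {K₁ K₂ K₃ : Graph m n} {a p p₁ p₂} →
    EdgeExtension K₁ K₃ a p₂ → EdgeExtension K₂ K₃ a p₁ → p₁ ≢ p₂ →
    AlwaysMatchedTo K₁ a p → AlwaysMatchedTo K₂ a p → AlwaysMatchedTo K₃ a p
  alwaysMatched-union {K₁} {K₂} {K₃} {a} {p} {p₁} {p₂} ext₁ ext₂ p₁≢p₂ always₁ always₂ N rmN@(mN , _)
    with maybe-≡-dec _≟_ (N a) (just p₂)
  ... | yes Na≡p₂ = always₂ N (rankMaximal-⊑ K₂ K₃ (extension-⊑ ext₂) N rmN
                      (extension-restrict ext₂ N (λ Na≡p₁ → p₁≢p₂ (just-injective (trans (sym Na≡p₁) Na≡p₂))) mN))
  ... | no Na≢p₂  = always₁ N (rankMaximal-⊑ K₁ K₃ (extension-⊑ ext₁) N rmN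
                      (extension-restrict ext₁ N Na≢p₂ mN))

module _ {n : ℕ} where

  row2-elsewhere : ∀ (p : Fin n) r p' r' {q} → q ≢ p → q ≢ p' → row2 p r p' r' q ≡ nothing
  row2-elsewhere p r p' r' {q} q≢p q≢p' with q ≟ p | q ≟ p'
  ... | yes q≡p | _        = ⊥-elim (q≢p q≡p)
  ... | no _    | yes q≡p' = ⊥-elim (q≢p' q≡p')
  ... | no _    | no _     = refl

  row3-without₃ : ∀ (p : Fin n) r p' r' p'' r'' {q} → q ≢ p'' →
    row3 p r p' r' p'' r'' q ≡ row2 p r p' r' q
  row3-without₃ p r p' r' p'' r'' {q} q≢p'' with q ≟ p
  ... | yes _ = refl
  ... | no _ with q ≟ p'
  ...   | yes _ = refl
  ...   | no _ with q ≟ p''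
  ...     | yes q≡p'' = ⊥-elim (q≢p'' q≡p'')
  ...     | no _      = refl

  row3-without₂ : ∀ (p : Fin n) r p' r' p'' r'' {q} → q ≢ p' →
    row3 p r p' r' p'' r'' q ≡ row2 p r p'' r'' q
  row3-without₂ p r p' r' p'' r'' {q} q≢p' with q ≟ p
  ... | yes _ = refl
  ... | no _ with q ≟ p'
  ...   | yes q≡p' = ⊥-elim (q≢p' q≡p')
  ...   | no _     = refl


lemma9 : ∀ {m n} (K₁ K₂ K₃ : Graph m n) (a : Fin m) (p p₁ p₂ : Fin n) (i j : ℕ) →
    PositiveRanks K₁ → PositiveRanks K₂ →
    (∀ a' → a' ≢ a → ∀ q → K₁ a' q ≡ K₂ a' q) →
    (∀ a' → a' ≢ a → ∀ q → K₃ a' q ≡ K₁ a' q) →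
    p ≢ p₁ → p ≢ p₂ → p₁ ≢ p₂ →
    (∀ q → K₁ a q ≡ row2 p 1 p₁ i q) →
    (∀ q → K₂ a q ≡ row2 p 1 p₂ j q) →
    (∀ q → K₃ a q ≡ row3 p 1 p₁ i p₂ j q) →
    IsFPost K₁ a p →
    ((AlwaysMatchedTo K₁ a p × AlwaysMatchedTo K₂ a p) ⇔ AlwaysMatchedTo K₃ a p)
lemma9 K₁ K₂ K₃ a p p₁ p₂ i j _ _ K₁≡K₂ K₃≡K₁ p≢p₁ p≢p₂ p₁≢p₂ row₁ row₂ row₃ _ =
  mk⇔ (λ (always₁ , always₂) → alwaysMatched-union ext₁ ext₂ p₁≢p₂ always₁ always₂)
      (λ always₃ → alwaysMatched-remove ext₁ p≢p₂ always₃ , alwaysMatched-remove ext₂ p≢p₁ always₃)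
  where
  ext₁ : EdgeExtension K₁ K₃ a p₂
  ext₁ = record
    { others = K₃≡K₁
    ; row    = λ q q≢p₂ → trans (row₃ q) (trans (row3-without₃ p 1 p₁ i p₂ j q≢p₂) (sym (row₁ q)))
    ; absent = trans (row₁ p₂) (row2-elsewhere p 1 p₁ i (≢-sym p≢p₂) (≢-sym p₁≢p₂))
    }
  ext₂ : EdgeExtension K₂ K₃ a p₁
  ext₂ = record
    { others = λ a' a'≢a q → trans (K₃≡K₁ a' a'≢a q) (K₁≡K₂ a' a'≢a q)
    ; row    = λ q q≢p₁ → trans (row₃ q) (trans (row3-without₂ p 1 p₁ i p₂ j q≢p₁) (sym (row₂ q)))
    ; absent = trans (row₂ p₁) (row2-elsewhere p 1 p₂ j (≢-sym p≢p₁) p₁≢p₂)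
    }
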